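{- Let $k\ge1$, let $a,b$ be bit-vectors of width $k$, let $\diamond\in\{\&,|,\oplus\}$ with corresponding uninterpreted function $F_\diamond\in\{\mathrm{AND},\mathrm{OR},\mathrm{XOR}\}$, and let $\mathcal{I}$ be an interpretation of $T_{UFIA}$ that satisfies the full axiom for $\mathrm{pow2}$ and the full axiom for $F_\diamond$. Then $\mathcal{I}$ satisfies $\mathrm{nat}(a\diamond b)=F_\diamond(k,\mathrm{nat}(a),\mathrm{nat}(b))$, where $a\diamond b$ is the bitwise and/or/xor of $a$ and $b$.
   Context: For a bit-vector $a=a[k-1]\dots a[0]$ of width $k$, $\mathrm{nat}(a)=\sum_{i=0}^{k-1}a[i]2^i$. $T_{UFIA}$ is integer arithmetic (with $\mathrm{div},\mathrm{mod}$ in SMT-LIB Euclidean semantics, $\min,\max$, absolute value, if-then-else $\mathrm{ite}$) together with uninterpreted functions $\mathrm{pow2}:\mathrm{Int}\to\mathrm{Int}$ and $\mathrm{AND},\mathrm{OR},\mathrm{XOR}:\mathrm{Int}^3\to\mathrm{Int}$. Write $\mathrm{hbit}(i,x)=(x\,\mathrm{div}\,\mathrm{pow2}(i))\bmod 2$. The full axiom for pow2 is $\mathrm{pow2}(0)=1\wedge\forall k.\,k>0\Rightarrow\mathrm{pow2}(k)=2\cdot\mathrm{pow2}(k-1)$. The full axiom for AND is $\forall k,x,y.\ \big(k>0\wedge 0\le x\le\mathrm{pow2}(k)-1\wedge0\le y\le\mathrm{pow2}(k)-1\big)\Rightarrow \mathrm{AND}(k,x,y)=\mathrm{ite}(k>1,\mathrm{AND}(k-1,x\bmod\mathrm{pow2}(k-1),y\bmod\mathrm{pow2}(k-1)),0)+\mathrm{pow2}(k-1)\cdot\min(\mathrm{hbit}(k-1,x),\mathrm{hbit}(k-1,y))$.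 The full axiom for OR is the same with $\mathrm{OR}$ in place of $\mathrm{AND}$ and $\max$ in place of $\min$; the full axiom for XOR is the same with $\mathrm{XOR}$ in place of $\mathrm{AND}$ and $|\mathrm{hbit}(k-1,x)-\mathrm{hbit}(k-1,y)|$ in place of the $\min$ term. -}

module Defs where

open import Data.Bool using (Bool; true; false; _∧_; _∨_; _xor_; if_then_else_)
open import Data.Nat using (ℕ; zero; suc)
import Data.Nat as ℕ
open import Data.Fin using (Fin; toℕ)
open import Data.Vec using (Vec; lookup; tabulate; zipWith; sum)
open import Data.Integer using (ℤ; +_; -[1+_]; _+_; _-_; _*_; _⊓_; _⊔_; ∣_∣; _≤_; _<_; 0ℤ; 1ℤ)
open import Data.Integer.DivMod using (_/_; _%_)
open import Data.Product using (_×_)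
open import Relation.Binary.PropositionalEquality using (_≡_)
open import Data.Integer.Properties using (_<?_)
open import Relation.Nullary using (does)

-- Bit-vectors of width k: a : Vec Bool k, with  lookup a i  = a[i]
-- (a[0] is the least significant bit).

bit : Bool → ℕ
bit true  = 1
bit false = 0

nat : ∀ {k} → Vec Bool k → ℕ
nat {k} a = sum (tabulate λ (i : Fin k) → bit (lookup a i) ℕ.* (2 ℕ.^ toℕ i))

data Op : Set where
  AND OR XOR : Op

boolOp : Op → Bool → Bool → Bool
boolOp AND = _∧_
boolOp OR  = _∨_
boolOp XOR = _xor_

bvOp : ∀ {k} → Op → Vec Bool k → Vec Bool k → Vec Bool k
bvOp op = zipWith (boolOp op)

-- SMT-LIB div/mod are Euclidean; division by 0 is left unspecified in
-- SMT-LIB, so an interpretation chooses arbitrary values div0 x, mod0 x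
-- for x div 0 and x mod 0.

record Interp : Set where
  field
    div0 : ℤ → ℤ
    mod0 : ℤ → ℤ
    pow2 : ℤ → ℤ
    fAND fOR fXOR : ℤ → ℤ → ℤ → ℤ

module _ (I : Interp) where
  open Interp I

  divI : ℤ → ℤ → ℤ
  divI x (+ zero)    = div0 x
  divI x d@(+ suc _) = x / d
  divI x d@(-[1+ _ ]) = x / d

  modI : ℤ → ℤ → ℤ
  modI x (+ zero)    = mod0 x
  modI x d@(+ suc _) = + (x % d)
  modI x d@(-[1+ _ ]) = + (x % d)

  ite : Bool → ℤ → ℤ → ℤ
  ite c x y = if c then x else y

  hbit : ℤ → ℤ → ℤ
  hbit i x = modI (divI x (pow2 i)) (+ 2)

  F : Op → ℤ → ℤ → ℤ → ℤ
  F AND = fAND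
  F OR  = fOR
  F XOR = fXOR

  bitTerm : Op → ℤ → ℤ → ℤ
  bitTerm AND u v = u ⊓ v
  bitTerm OR  u v = u ⊔ v
  bitTerm XOR u v = + ∣ u - v ∣

  Pow2Axiom : Set
  Pow2Axiom = (pow2 0ℤ ≡ 1ℤ) × (∀ k → 0ℤ < k → pow2 k ≡ + 2 * pow2 (k - 1ℤ))

  FullAxiom : Op → Set
  FullAxiom op = ∀ k x y →
    0ℤ < k → 0ℤ ≤ x → x ≤ pow2 k - 1ℤ → 0ℤ ≤ y → y ≤ pow2 k - 1ℤ →
    F op k x y ≡
      ite (does (1ℤ <? k))
          (F op (k - 1ℤ) (modI x (pow2 (k - 1ℤ))) (modI y (pow2 (k - 1ℤ))))
          0ℤ
      + pow2 (k - 1ℤ) * bitTerm op (hbit (k - 1ℤ) x) (hbit (k - 1ℤ) y)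

-- Split off the top bit: for x = A + a·2^m and y = B + b·2^m with A, B < 2^m, the
-- pow2 axiom gives pow2(m) = 2^m, so x mod pow2(m) = A and hbit(m, x) = a, and on bits
-- min / max / |·-·| are and / or / xor.  The axiom at width m + 1 therefore reads
-- F(m+1, x, y) = F(m, A, B) + 2^m (a ⋄ b) (without the first summand when m = 0), which
-- is how nat(a ⋄ b) decomposes as well; induction on the width finishes.
module Submission where

open import Defs
open import Data.Nat using (ℕ; _≤_)
open import Data.Bool using (Bool)
open import Data.Vec using (Vec)
open import Data.Integer using (+_)
open import Relation.Binary.PropositionalEquality using (_≡_)

open import Data.Bool using (true; false)
open import Data.Nat as ℕ using (zero; suc; _^_; _<_; NonZero; s≤s; z≤n)
import Data.Nat.Properties as ℕ
open import Data.Nat.DivMod using ([m+kn]%n≡m%n; m<n⇒m%n≡m; +-distrib-/-∣ʳ; m<n⇒m/n≡0; m*n/n≡m)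
open import Data.Nat.Divisibility using (divides-refl)
open import Data.Fin using (Fin; zero; suc; toℕ; inject₁; fromℕ)
open import Data.Fin.Properties using (toℕ-inject₁; toℕ-fromℕ)
open import Data.Vec using (tabulate; sum; lookup)
open import Data.Vec.Functional using (init; last)
open import Data.Vec.Properties using (tabulate-cong; lookup-zipWith)
open import Data.Integer as ℤ using (0ℤ; 1ℤ; +≤+; +<+)
open import Data.Integer.Properties using (pos-+; pos-*; *-comm; _<?_)
open import Data.Integer.DivMod using (div-pos-is-/ℕ)
open import Data.Product using (proj₁; proj₂)
open import Relation.Nullary using (does)
open import Relation.Binary.PropositionalEquality using (refl; sym; trans; cong; cong₂; subst; module ≡-Reasoning)

sum-tabulate-last : ∀ k (g : Fin (suc k) → ℕ) →
  sum (tabulate g) ≡ sum (tabulate (λ i → g (inject₁ i))) ℕ.+ g (fromℕ k)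
sum-tabulate-last zero    g = ℕ.+-comm (g zero) 0
sum-tabulate-last (suc k) g =
  trans (cong (g zero ℕ.+_) (sum-tabulate-last k (λ i → g (suc i))))
        (sym (ℕ.+-assoc (g zero) _ _))

value : ∀ {k} → (Fin k → Bool) → ℕ
value {k} f = sum (tabulate λ (i : Fin k) → bit (f i) ℕ.* 2 ^ toℕ i)

value-last : ∀ m (f : Fin (suc m) → Bool) → value f ≡ value (init f) ℕ.+ bit (last f) ℕ.* 2 ^ m
value-last m f = trans (sum-tabulate-last m λ i → bit (f i) ℕ.* 2 ^ toℕ i) (cong₂ ℕ._+_ low high)
  where
  low : sum (tabulate λ i → bit (f (inject₁ i)) ℕ.* 2 ^ toℕ (inject₁ i)) ≡ value (init f)
  low = cong sum (tabulate-cong λ i → cong (λ e → bit (f (inject₁ i)) ℕ.* 2 ^ e) (toℕ-inject₁ i))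
  high : bit (last f) ℕ.* 2 ^ toℕ (fromℕ m) ≡ bit (last f) ℕ.* 2 ^ m
  high = cong (λ e → bit (f (fromℕ m)) ℕ.* 2 ^ e) (toℕ-fromℕ m)

+-bit*-< : ∀ {A d} (b : Bool) → A < d → A ℕ.+ bit b ℕ.* d < 2 ℕ.* d
+-bit*-< {A} {d} false A<d rewrite ℕ.+-identityʳ A = ℕ.<-≤-trans A<d (ℕ.m≤m+n d (d ℕ.+ 0))
+-bit*-< {A} {d} true  A<d = ℕ.+-monoˡ-< (d ℕ.+ 0) A<d

value<2^ : ∀ {k} (f : Fin k → Bool) → value f < 2 ^ k
value<2^ {zero}  f = s≤s z≤n
value<2^ {suc m} f rewrite value-last m f = +-bit*-< (last f) (value<2^ (init f))

bitwise : ∀ {k} → Op → (Fin k → Bool) → (Fin k → Bool) → Fin k → Bool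
bitwise op f g i = boolOp op (f i) (g i)

nat-bvOp : ∀ {k} op (a b : Vec Bool k) →
  nat (bvOp op a b) ≡ value (bitwise op (lookup a) (lookup b))
nat-bvOp op a b =
  cong sum (tabulate-cong λ i → cong (λ c → bit c ℕ.* 2 ^ toℕ i) (lookup-zipWith _ i a b))

bitTerm-bit : ∀ I op (b c : Bool) → bitTerm I op (+ bit b) (+ bit c) ≡ + bit (boolOp op b c)
bitTerm-bit I AND false c     = refl
bitTerm-bit I AND true  false = refl
bitTerm-bit I AND true  true  = refl
bitTerm-bit I OR  false false = refl
bitTerm-bit I OR  false true  = refl
bitTerm-bit I OR  true  false = refl
bitTerm-bit I OR  true  true  = refl
bitTerm-bit I XOR false false = refl
bitTerm-bit I XOR false true  = refl
bitTerm-bit I XOR true  false = refl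
bitTerm-bit I XOR true  true  = refl

<⇒≤-1 : ∀ x d → x < d → + x ℤ.≤ + d ℤ.- 1ℤ
<⇒≤-1 x (suc p) (s≤s x≤p) = +≤+ x≤p

module _ (I : Interp) where
  open Interp I

  modI-+* : ∀ A c d .{{_ : NonZero d}} → A < d → modI I (+ (A ℕ.+ c ℕ.* d)) (+ d) ≡ + A
  modI-+* A c (suc p) A<d = cong +_ (trans ([m+kn]%n≡m%n A c (suc p)) (m<n⇒m%n≡m A<d))

  divI-+* : ∀ A c d .{{_ : NonZero d}} → A < d → divI I (+ (A ℕ.+ c ℕ.* d)) (+ d) ≡ + c
  divI-+* A c (suc p) A<d = trans (div-pos-is-/ℕ (+ (A ℕ.+ c ℕ.* suc p)) (suc p))
    (cong +_ (trans (+-distrib-/-∣ʳ A (divides-refl c))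
                    (cong₂ ℕ._+_ (m<n⇒m/n≡0 A<d) (m*n/n≡m c (suc p)))))

  module _ (pow2-axiom : Pow2Axiom I) where

    pow2≡2^ : ∀ m → pow2 (+ m) ≡ + 2 ^ m
    pow2≡2^ zero    = proj₁ pow2-axiom
    pow2≡2^ (suc m) = trans (proj₂ pow2-axiom (+ suc m) (+<+ (s≤s z≤n)))
                            (trans (cong (+ 2 ℤ.*_) (pow2≡2^ m)) (sym (pos-* 2 (2 ^ m))))

    <⇒≤pow2-1 : ∀ {x} k → x < 2 ^ k → + x ℤ.≤ pow2 (+ k) ℤ.- 1ℤ
    <⇒≤pow2-1 {x} k x<2^k = subst (λ p → + x ℤ.≤ p ℤ.- 1ℤ) (sym (pow2≡2^ k)) (<⇒≤-1 x (2 ^ k) x<2^k)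

    module _ (m A : ℕ) (b : Bool) (A<2^m : A < 2 ^ m) where
      private
        instance
          2^m≢0 : NonZero (2 ^ m)
          2^m≢0 = ℕ.m^n≢0 2 m

      modI-pow2-top : modI I (+ (A ℕ.+ bit b ℕ.* 2 ^ m)) (pow2 (+ m)) ≡ + A
      modI-pow2-top = trans (cong (modI I _) (pow2≡2^ m)) (modI-+* A (bit b) (2 ^ m) A<2^m)

      hbit-top : hbit I (+ m) (+ (A ℕ.+ bit b ℕ.* 2 ^ m)) ≡ + bit b
      hbit-top = trans (cong (λ q → modI I q (+ 2)) quotient) (bit-mod-2 b)
        where
        quotient : divI I (+ (A ℕ.+ bit b ℕ.* 2 ^ m)) (pow2 (+ m)) ≡ + bit b
        quotient = trans (cong (divI I _) (pow2≡2^ m)) (divI-+* A (bit b) (2 ^ m) A<2^m)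
        bit-mod-2 : ∀ c → modI I (+ bit c) (+ 2) ≡ + bit c
        bit-mod-2 false = refl
        bit-mod-2 true  = refl

    module _ (op : Op) (F-axiom : FullAxiom I op) where

      F-split-top : ∀ m A B b c → A < 2 ^ m → B < 2 ^ m →
        F I op (+ suc m) (+ (A ℕ.+ bit b ℕ.* 2 ^ m)) (+ (B ℕ.+ bit c ℕ.* 2 ^ m)) ≡
        ite I (does (1ℤ <? + suc m)) (F I op (+ m) (+ A) (+ B)) 0ℤ ℤ.+ + (bit (boolOp op b c) ℕ.* 2 ^ m)
      F-split-top m A B b c A<2^m B<2^m = begin
        F I op (+ suc m) x y
          ≡⟨ F-axiom (+ suc m) x y (+<+ (s≤s z≤n)) (+≤+ z≤n) (<⇒≤pow2-1 (suc m) (+-bit*-< b A<2^m))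
                                            (+≤+ z≤n) (<⇒≤pow2-1 (suc m) (+-bit*-< c B<2^m)) ⟩
        ite I (does (1ℤ <? + suc m)) (F I op (+ m) (modI I x (pow2 (+ m))) (modI I y (pow2 (+ m)))) 0ℤ
          ℤ.+ pow2 (+ m) ℤ.* bitTerm I op (hbit I (+ m) x) (hbit I (+ m) y)
          ≡⟨ cong₂ ℤ._+_ (cong₂ (λ u v → ite I (does (1ℤ <? + suc m)) (F I op (+ m) u v) 0ℤ)
                                (modI-pow2-top m A b A<2^m) (modI-pow2-top m B c B<2^m))
                         (cong₂ ℤ._*_ (pow2≡2^ m) top-bit) ⟩
        low ℤ.+ + 2 ^ m ℤ.* + bit (boolOp op b c)
          ≡⟨ cong (λ t → low ℤ.+ t) (trans (*-comm (+ 2 ^ m) (+ bit (boolOp op b c)))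
                                           (sym (pos-* (bit (boolOp op b c)) (2 ^ m)))) ⟩
        low ℤ.+ + (bit (boolOp op b c) ℕ.* 2 ^ m) ∎
        where
        open ≡-Reasoning
        x = + (A ℕ.+ bit b ℕ.* 2 ^ m)
        y = + (B ℕ.+ bit c ℕ.* 2 ^ m)
        low = ite I (does (1ℤ <? + suc m)) (F I op (+ m) (+ A) (+ B)) 0ℤ
        top-bit : bitTerm I op (hbit I (+ m) x) (hbit I (+ m) y) ≡ + bit (boolOp op b c)
        top-bit = trans (cong₂ (bitTerm I op) (hbit-top m A b A<2^m) (hbit-top m B c B<2^m))
                        (bitTerm-bit I op b c)

      value-bitwise-step : ∀ m (f g : Fin (suc m) → Bool) →
        + value (bitwise op (init f) (init g)) ≡
          ite I (does (1ℤ <? + suc m)) (F I op (+ m) (+ value (init f)) (+ value (init g))) 0ℤ →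
        + value (bitwise op f g) ≡ F I op (+ suc m) (+ value f) (+ value g)
      value-bitwise-step m f g lower = begin
        + value (bitwise op f g)
          ≡⟨ cong +_ (value-last m (bitwise op f g)) ⟩
        + (value (bitwise op (init f) (init g)) ℕ.+ bit (boolOp op (last f) (last g)) ℕ.* 2 ^ m)
          ≡⟨ pos-+ (value (bitwise op (init f) (init g))) _ ⟩
        + value (bitwise op (init f) (init g)) ℤ.+ + (bit (boolOp op (last f) (last g)) ℕ.* 2 ^ m)
          ≡⟨ cong (ℤ._+ _) lower ⟩
        ite I (does (1ℤ <? + suc m)) (F I op (+ m) (+ value (init f)) (+ value (init g))) 0ℤ
          ℤ.+ + (bit (boolOp op (last f) (last g)) ℕ.* 2 ^ m)
          ≡⟨ F-split-top m _ _ (last f) (last g) (value<2^ (init f)) (value<2^ (init g)) ⟨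
        F I op (+ suc m) (+ (value (init f) ℕ.+ bit (last f) ℕ.* 2 ^ m))
                         (+ (value (init g) ℕ.+ bit (last g) ℕ.* 2 ^ m))
          ≡⟨ cong₂ (λ u v → F I op (+ suc m) (+ u) (+ v)) (value-last m f) (value-last m g) ⟨
        F I op (+ suc m) (+ value f) (+ value g) ∎
        where open ≡-Reasoning

      value-bitwise : ∀ m (f g : Fin (suc m) → Bool) →
        + value (bitwise op f g) ≡ F I op (+ suc m) (+ value f) (+ value g)
      -- At width 1 the guard k > 1 fails, so both sides of the hypothesis compute to 0.
      value-bitwise zero    f g = value-bitwise-step zero f g refl
      value-bitwise (suc m) f g = value-bitwise-step (suc m) f g (value-bitwise m (init f) (init g))

lemma4 : (k : ℕ) → 1 ≤ k → (a b : Vec Bool k) → (op : Op) → (I : Interp) →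
    Pow2Axiom I → FullAxiom I op →
    + nat (bvOp op a b) ≡ F I op (+ k) (+ nat a) (+ nat b)
lemma4 (suc m) _ a b op I pow2-axiom F-axiom =
  trans (cong +_ (nat-bvOp op a b)) (value-bitwise I pow2-axiom op F-axiom m (lookup a) (lookup b))
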